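{- Let $Q$ be a binary matroid and $a\in E(Q)$ an element that is neither a loop nor a coloop, such that $Q\backslash a=M(F)$. Then: (i) $Q/a$ contains at most two loops; (ii) $Q/a$ has no cocircuit of size $2$; (iii) $Q/a$ does not contain more than four mutually parallel elements.
   Context: $F$ is the graph on three vertices $u,v,w$ with two parallel edges between $u$ and $v$, two parallel edges between $u$ and $w$, and one edge between $v$ and $w$; $M(F)$ is its cycle matroid. -}

module Defs where

open import Data.Nat using (ℕ; zero; suc; _<_)
open import Data.Bool using (Bool; true; false; _xor_; if_then_else_)
open import Data.Fin using (Fin; zero; suc)
open import Data.Fin.Subset using (Subset; _∈_; _∉_; _⊆_; _⊂_; _∪_; _∩_; ∁; ⁅_⁆; ∣_∣; Nonempty; Empty) renaming (⊥ to ∅; ⊤ to full)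
open import Data.Vec using (Vec; replicate; zipWith; lookup; tabulate)
open import Data.Product using (Σ; ∃; _×_; _,_)
open import Data.Sum using (_⊎_)
open import Relation.Binary.PropositionalEquality using (_≡_; _≢_)
open import Relation.Nullary using (¬_)
open import Function.Definitions using (Injective)

record Matroid (n : ℕ) : Set₁ where
  field
    Indep    : Subset n → Set
    indep-∅  : Indep ∅
    indep-⊆  : ∀ X Y → X ⊆ Y → Indep Y → Indep X
    augment  : ∀ X Y → Indep X → Indep Y → ∣ X ∣ < ∣ Y ∣ →
               ∃ λ e → e ∈ Y × e ∉ X × Indep (X ∪ ⁅ e ⁆)
open Matroid public

-- Generic notions for an independence system (E , I), where the ground
-- set E is a subset of Fin n (used for minors of a matroid on Fin n).

IsBasis : ∀ {n} → Subset n → (Subset n → Set) → Subset n → Set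
IsBasis E I B = B ⊆ E × I B × (∀ Y → Y ⊆ E → B ⊆ Y → I Y → Y ≡ B)

IsCircuit : ∀ {n} → Subset n → (Subset n → Set) → Subset n → Set
IsCircuit E I C = C ⊆ E × ¬ I C × (∀ D → D ⊂ C → I D)

DualIndep : ∀ {n} → Subset n → (Subset n → Set) → Subset n → Set
DualIndep E I X = X ⊆ E × ∃ λ B → IsBasis E I B × Empty (X ∩ B)

IsCocircuit : ∀ {n} → Subset n → (Subset n → Set) → Subset n → Set
IsCocircuit E I C = IsCircuit E (DualIndep E I) C

IsLoop : ∀ {n} → Subset n → (Subset n → Set) → Fin n → Set
IsLoop E I e = IsCircuit E I ⁅ e ⁆

IsColoop : ∀ {n} → Subset n → (Subset n → Set) → Fin n → Set
IsColoop E I e = e ∈ E × (∀ B → IsBasis E I B → e ∈ B)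

IsParallel : ∀ {n} → Subset n → (Subset n → Set) → Fin n → Fin n → Set
IsParallel E I e f = e ≢ f × IsCircuit E I (⁅ e ⁆ ∪ ⁅ f ⁆)

minorGround : ∀ {n} → Fin n → Subset n
minorGround a = ∁ ⁅ a ⁆

DelIndep : ∀ {n} → Matroid n → Fin n → Subset n → Set
DelIndep Q a X = X ⊆ minorGround a × Indep Q X

-- Q / a (a not a loop) : X ⊆ E - a is independent iff X ∪ {a} is independent in Q
ConIndep : ∀ {n} → Matroid n → Fin n → Subset n → Set
ConIndep Q a X = X ⊆ minorGround a × Indep Q (X ∪ ⁅ a ⁆)

-- A column matrix A : Fin n → Vec Bool m; a set X of columns is linearly
-- independent over GF(2) iff no nonempty subset of X sums to zero
-- (GF(2)-coefficients are 0/1, so a linear combination is a subset sum).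

vzero : ∀ m → Vec Bool m
vzero m = replicate _ false

sumCols : ∀ {n m} → (Fin n → Vec Bool m) → Subset n → Vec Bool m
sumCols {zero}  {m} A Y = vzero m
sumCols {suc n} {m} A Y =
  zipWith _xor_ (if lookup Y zero then A zero else vzero m)
                (sumCols (λ i → A (suc i)) (tabulate (λ i → lookup Y (suc i))))

LinIndepGF2 : ∀ {n m} → (Fin n → Vec Bool m) → Subset n → Set
LinIndepGF2 {m = m} A X = ∀ Y → Y ⊆ X → Nonempty Y → sumCols A Y ≢ vzero m

IsBinary : ∀ {n} → Matroid n → Set
IsBinary {n} Q = ∃ λ (m : ℕ) → Σ (Fin n → Vec Bool m) λ A →
  ∀ X → (Indep Q X → LinIndepGF2 A X) × (LinIndepGF2 A X → Indep Q X)

Graph : ℕ → ℕ → Set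
Graph k m = Fin m → Fin k × Fin k

Joins : ∀ {k m} → Graph k m → Fin m → Fin k → Fin k → Set
Joins G e x y = G e ≡ (x , y) ⊎ G e ≡ (y , x)

-- cyclic successor on Fin (suc l): i ↦ i + 1, and the last index ↦ 0
next : ∀ {l} → Fin (suc l) → Fin (suc l)
next {zero}  zero    = zero
next {suc l} zero    = suc zero
next {suc l} (suc i) with next {l} i
... | zero  = zero
... | suc j = suc (suc j)

-- a cycle of length suc l: distinct vertices v_0 .. v_l and distinct edges
-- e_0 .. e_l with e_i joining v_i and v_(i+1 mod (l+1))
-- (length 1 = a loop, length 2 = a pair of parallel edges)
record Cycle {k m : ℕ} (G : Graph k m) : Set where
  field
    len    : ℕ
    verts  : Fin (suc len) → Fin k
    edges  : Fin (suc len) → Fin m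
    verts-inj : Injective _≡_ _≡_ verts
    edges-inj : Injective _≡_ _≡_ edges
    joins  : ∀ i → Joins G (edges i) (verts i) (verts (next i))

CycleIndep : ∀ {k m} → Graph k m → Subset m → Set
CycleIndep G X = ¬ (Σ (Cycle G) λ c → ∀ i → Cycle.edges c i ∈ X)

-- The graph F: vertices u = 0, v = 1, w = 2; edges
-- 0,1 : u–v (parallel), 2,3 : u–w (parallel), 4 : v–w.

F : Graph 3 5
F zero                            = zero , suc zero
F (suc zero)                      = zero , suc zero
F (suc (suc zero))                = zero , suc (suc zero)
F (suc (suc (suc zero)))          = zero , suc (suc zero)
F (suc (suc (suc (suc zero))))    = suc zero , suc (suc zero)

preimage : ∀ {p n} → (Fin p → Fin n) → Subset n → Subset p
preimage φ Y = tabulate (λ i → lookup Y (φ i))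

DeletionIsoMF : ∀ {n} → Matroid n → Fin n → Set
DeletionIsoMF {n} Q a = Σ (Fin 5 → Fin n) λ φ →
  Injective _≡_ _≡_ φ × (∀ i → φ i ≢ a) × (∀ e → e ≢ a → ∃ λ i → φ i ≡ e) ×
  (∀ X → X ⊆ minorGround a →
     (DelIndep Q a X → CycleIndep F (preimage φ X)) ×
     (CycleIndep F (preimage φ X) → DelIndep Q a X))

module Submission where

open import Defs
open import Data.Nat using (ℕ; zero; suc; _≤_; _<_; _≤?_)
open import Data.Nat.Properties using (≰⇒>; <-irrefl; module ≤-Reasoning)
open import Data.Bool using (Bool; true; false; _xor_; if_then_else_)
open import Data.Bool.Properties using (xor-comm; xor-assoc; xor-identityˡ; xor-identityʳ; xor-same) renaming (_≟_ to _≟ᵇ_)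
open import Data.Fin using (Fin; zero; suc; _≟_; punchOut)
open import Data.Fin.Properties using (all?; any?; punchOut-injective; injective⇒≤)
open import Data.Fin.Subset using (Subset; ⁅_⁆; _∈_; _∉_; _⊆_; _⊂_; _∪_; _∩_; _─_; _-_; ∣_∣; Empty) renaming (⊥ to ∅; ⊤ to full)
open import Data.Fin.Subset.Properties using (x∈⁅x⁆; x∈⁅y⁆⇒x≡y; x∈p∪q⁻; x∈p∪q⁺; x∈p∩q⁻; x∉p⇒x∈∁p; x∈∁p⇒x∉p; ∈⊤; ∉⊥; Empty-unique; p─⊥≡p; p─q⊆p; p⊆p∪q; q⊆p∪q; ∪-assoc; ∪-identityˡ; ⊆-refl; ⊆-antisym; p⊆q⇒∣p∣≤∣q∣; ∣⁅x⁆∣≡1; _∈?_)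
open import Data.Vec using (Vec; []; _∷_; zipWith; lookup)
open import Data.Vec.Base using (_[_]=_)
open import Data.Vec.Properties using (tabulate∘lookup; lookup∘tabulate; lookup⇒[]=; []=⇒lookup; zipWith-comm; zipWith-assoc; zipWith-identityˡ; zipWith-identityʳ) renaming (≡-dec to ≡-decᵥ)
open import Data.Product using (∃; _×_; _,_; proj₁; proj₂)
open import Data.Product.Properties using () renaming (≡-dec to ≡-dec₂)
open import Data.Sum using (_⊎_; inj₁; inj₂; swap)
import Data.Sum as Sum
open import Data.Empty using (⊥; ⊥-elim)
open import Function using (_∘_)
open import Function.Definitions using (Injective)
open import Relation.Nullary using (¬_; Dec; yes; no)
open import Relation.Nullary.Decidable using (True; toWitness; from-yes; decidable-stable; ¬?; _⊎-dec_; _×-dec_; _→-dec_)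
open import Relation.Binary.PropositionalEquality

open _[_]=_

-- Fix a GF(2) representation A of Q. Since Q \ a is the cycle matroid of F, the five columns of
-- E(Q) - a take only three values: both edges of a parallel class of F share a column, and the
-- three class columns are nonzero, pairwise distinct and sum to zero (the triangle). Hence any three
-- elements whose columns are class columns are dependent. If the column of a were none of them,
-- a would lie in every basis of Q; so A a is the column of one class r, and Q / a has rank 1.
-- Its loops are the elements parallel to a, i.e. the at most two edges of class r; each of the
-- three other edges is a basis of Q / a on its own, so a cocircuit must contain all three; and
-- five mutually parallel elements would exhaust E(Q) - a, class r included.

-- GF(2) vectors

infixr 6 _⊕_
infix 7 _·_

_⊕_ : ∀ {m} → Vec Bool m → Vec Bool m → Vec Bool m
u ⊕ v = zipWith _xor_ u v

_·_ : ∀ {m} → Bool → Vec Bool m → Vec Bool m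
b · v = if b then v else vzero _

⊕-self : ∀ {m} (u : Vec Bool m) → u ⊕ u ≡ vzero m
⊕-self []      = refl
⊕-self (x ∷ u) = cong₂ _∷_ (xor-same x) (⊕-self u)

module _ {m : ℕ} where

  ⊕-comm : (u v : Vec Bool m) → u ⊕ v ≡ v ⊕ u
  ⊕-comm = zipWith-comm xor-comm

  ⊕-assoc : (u v w : Vec Bool m) → (u ⊕ v) ⊕ w ≡ u ⊕ v ⊕ w
  ⊕-assoc = zipWith-assoc xor-assoc

  ⊕-identityˡ : (u : Vec Bool m) → vzero m ⊕ u ≡ u
  ⊕-identityˡ = zipWith-identityˡ xor-identityˡ

  ⊕-identityʳ : (u : Vec Bool m) → u ⊕ vzero m ≡ u
  ⊕-identityʳ = zipWith-identityʳ xor-identityʳ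

  ⊕-cancelˡ : (u v : Vec Bool m) → u ⊕ u ⊕ v ≡ v
  ⊕-cancelˡ u v = begin
    u ⊕ u ⊕ v     ≡⟨ ⊕-assoc u u v ⟨
    (u ⊕ u) ⊕ v   ≡⟨ cong (_⊕ v) (⊕-self u) ⟩
    vzero m ⊕ v   ≡⟨ ⊕-identityˡ v ⟩
    v             ∎
    where open ≡-Reasoning

  ⊕-swap : ∀ {u v w : Vec Bool m} → u ⊕ v ≡ w → u ⊕ w ≡ v
  ⊕-swap {u} {v} refl = ⊕-cancelˡ u v

  ⊕≡0⇒≡ : ∀ {u v : Vec Bool m} → u ⊕ v ≡ vzero m → u ≡ v
  ⊕≡0⇒≡ {u} eq = trans (sym (⊕-identityʳ u)) (⊕-swap eq)

∈⁅x⁆∪p⁻ : ∀ {n} {i x : Fin n} {p} → i ∈ ⁅ x ⁆ ∪ p → i ≡ x ⊎ i ∈ p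
∈⁅x⁆∪p⁻ {x = x} {p} i∈ with x∈p∪q⁻ ⁅ x ⁆ p i∈
... | inj₁ i∈⁅x⁆ = inj₁ (x∈⁅y⁆⇒x≡y x i∈⁅x⁆)
... | inj₂ i∈p   = inj₂ i∈p

x∈⁅x⁆∪p : ∀ {n} (x : Fin n) {p} → x ∈ ⁅ x ⁆ ∪ p
x∈⁅x⁆∪p x = x∈p∪q⁺ (inj₁ (x∈⁅x⁆ x))

p⊆⁅x⁆∪p : ∀ {n} (x : Fin n) {p} → p ⊆ ⁅ x ⁆ ∪ p
p⊆⁅x⁆∪p x i∈ = x∈p∪q⁺ (inj₂ i∈)

⁅x⁆⊆p : ∀ {n} {x : Fin n} {p} → x ∈ p → ⁅ x ⁆ ⊆ p
⁅x⁆⊆p {x = x} {p} x∈p i∈ = subst (_∈ p) (sym (x∈⁅y⁆⇒x≡y x i∈)) x∈p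

⁅x⁆∪p⊆q : ∀ {n} {x : Fin n} {p q} → x ∈ q → p ⊆ q → ⁅ x ⁆ ∪ p ⊆ q
⁅x⁆∪p⊆q {q = q} x∈q p⊆q i∈ with ∈⁅x⁆∪p⁻ i∈
... | inj₁ refl = x∈q
... | inj₂ i∈p  = p⊆q i∈p

x∉⁅y⁆∪⁅z⁆ : ∀ {n} {x y z : Fin n} → x ≢ y → x ≢ z → x ∉ ⁅ y ⁆ ∪ ⁅ z ⁆
x∉⁅y⁆∪⁅z⁆ x≢y x≢z x∈ with ∈⁅x⁆∪p⁻ x∈
... | inj₁ x≡y = x≢y x≡y
... | inj₂ x∈⁅z⁆ = x≢z (x∈⁅y⁆⇒x≡y _ x∈⁅z⁆)

x∉p⇒Empty[p∩⁅x⁆] : ∀ {n} {x : Fin n} {p} → x ∉ p → Empty (p ∩ ⁅ x ⁆)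
x∉p⇒Empty[p∩⁅x⁆] {x = x} {p} x∉p (i , i∈) with x∈p∩q⁻ p ⁅ x ⁆ i∈
... | i∈p , i∈⁅x⁆ = x∉p (subst (_∈ p) (x∈⁅y⁆⇒x≡y x i∈⁅x⁆) i∈p)

∈preimage⁺ : ∀ {p n} (φ : Fin p → Fin n) {X i} → φ i ∈ X → i ∈ preimage φ X
∈preimage⁺ φ {X} {i} φi∈X = lookup⇒[]= i (preimage φ X) (trans (lookup∘tabulate _ i) ([]=⇒lookup φi∈X))

∈preimage⁻ : ∀ {p n} (φ : Fin p → Fin n) {X i} → i ∈ preimage φ X → φ i ∈ X
∈preimage⁻ φ {X} {i} i∈ = lookup⇒[]= (φ i) X (trans (sym (lookup∘tabulate _ i)) ([]=⇒lookup i∈))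

∣⁅x⁆∪p∣≡1+∣p∣ : ∀ {n} (x : Fin n) (p : Subset n) → x ∉ p → ∣ ⁅ x ⁆ ∪ p ∣ ≡ suc ∣ p ∣
∣⁅x⁆∪p∣≡1+∣p∣ zero    (true  ∷ p) x∉p = ⊥-elim (x∉p here)
∣⁅x⁆∪p∣≡1+∣p∣ zero    (false ∷ p) x∉p = cong (λ q → suc ∣ q ∣) (∪-identityˡ p)
∣⁅x⁆∪p∣≡1+∣p∣ (suc x) (true  ∷ p) x∉p = cong suc (∣⁅x⁆∪p∣≡1+∣p∣ x p (λ x∈ → x∉p (there x∈)))
∣⁅x⁆∪p∣≡1+∣p∣ (suc x) (false ∷ p) x∉p = ∣⁅x⁆∪p∣≡1+∣p∣ x p (λ x∈ → x∉p (there x∈))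

∣⁅x⁆∪⁅y⁆∣≡2 : ∀ {n} {x y : Fin n} → x ≢ y → ∣ ⁅ x ⁆ ∪ ⁅ y ⁆ ∣ ≡ 2
∣⁅x⁆∪⁅y⁆∣≡2 {x = x} {y} x≢y =
  trans (∣⁅x⁆∪p∣≡1+∣p∣ x ⁅ y ⁆ (λ x∈ → x≢y (x∈⁅y⁆⇒x≡y y x∈))) (cong suc (∣⁅x⁆∣≡1 y))

∣⁅x⁆∪⁅y⁆∪⁅z⁆∣≡3 : ∀ {n} {x y z : Fin n} → x ≢ y → x ≢ z → y ≢ z → ∣ ⁅ x ⁆ ∪ ⁅ y ⁆ ∪ ⁅ z ⁆ ∣ ≡ 3
∣⁅x⁆∪⁅y⁆∪⁅z⁆∣≡3 {x = x} x≢y x≢z y≢z =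
  trans (∣⁅x⁆∪p∣≡1+∣p∣ x _ (x∉⁅y⁆∪⁅z⁆ x≢y x≢z)) (cong suc (∣⁅x⁆∪⁅y⁆∣≡2 y≢z))

x∉p-x : ∀ {n} (p : Subset n) x → x ∉ p - x
x∉p-x (b ∷ p) zero    ()
x∉p-x (b ∷ p) (suc x) (there x∈) = x∉p-x p x x∈

lookup[p-x]≡lookup[p] : ∀ {n} (p : Subset n) {x i} → i ≢ x → lookup (p - x) i ≡ lookup p i
lookup[p-x]≡lookup[p] (b ∷ p) {zero}  {zero}  i≢x = ⊥-elim (i≢x refl)
lookup[p-x]≡lookup[p] (b ∷ p) {suc x} {zero}  i≢x = refl
lookup[p-x]≡lookup[p] (b ∷ p) {zero}  {suc i} i≢x = cong (λ q → lookup q i) (p─⊥≡p p)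
lookup[p-x]≡lookup[p] (b ∷ p) {suc x} {suc i} i≢x = lookup[p-x]≡lookup[p] p (λ i≡x → i≢x (cong suc i≡x))

q⊆⁅x⁆∪p⇒q-x⊆p : ∀ {n} {x : Fin n} {p q} → q ⊆ ⁅ x ⁆ ∪ p → q - x ⊆ p
q⊆⁅x⁆∪p⇒q-x⊆p {x = x} {p} {q} q⊆ {i} i∈ with ∈⁅x⁆∪p⁻ (q⊆ (p─q⊆p q ⁅ x ⁆ i∈))
... | inj₁ refl = ⊥-elim (x∉p-x q i i∈)
... | inj₂ i∈p  = i∈p

∈⁅x⁆∪⁅y⁆⁻ : ∀ {n} {i x y : Fin n} → i ∈ ⁅ x ⁆ ∪ ⁅ y ⁆ → i ≡ x ⊎ i ≡ y
∈⁅x⁆∪⁅y⁆⁻ i∈ with ∈⁅x⁆∪p⁻ i∈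
... | inj₁ i≡x   = inj₁ i≡x
... | inj₂ i∈⁅y⁆ = inj₂ (x∈⁅y⁆⇒x≡y _ i∈⁅y⁆)

∈⁅x⁆∪⁅y⁆∪⁅z⁆⁻ : ∀ {n} {i x y z : Fin n} → i ∈ ⁅ x ⁆ ∪ ⁅ y ⁆ ∪ ⁅ z ⁆ →
                i ≡ x ⊎ i ≡ y ⊎ i ≡ z
∈⁅x⁆∪⁅y⁆∪⁅z⁆⁻ i∈ with ∈⁅x⁆∪p⁻ i∈
... | inj₁ i≡x = inj₁ i≡x
... | inj₂ i∈  = inj₂ (∈⁅x⁆∪⁅y⁆⁻ i∈)

lookup≡false⇒∉ : ∀ {n} {Y : Subset n} {x} → lookup Y x ≡ false → x ∉ Y
lookup≡false⇒∉ Yx≡false x∈Y with trans (sym ([]=⇒lookup x∈Y)) Yx≡false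
... | ()

module _ {m : ℕ} where

  sumCols-∷ : ∀ {n} (A : Fin (suc n) → Vec Bool m) b (Y : Subset n) →
              sumCols A (b ∷ Y) ≡ b · A zero ⊕ sumCols (λ i → A (suc i)) Y
  sumCols-∷ A b Y = cong (λ Z → b · A zero ⊕ sumCols (λ i → A (suc i)) Z) (tabulate∘lookup Y)

  sumCols-∅ : ∀ {n} (A : Fin n → Vec Bool m) → sumCols A ∅ ≡ vzero m
  sumCols-∅ {zero}  A = refl
  sumCols-∅ {suc n} A = begin
    sumCols A ∅                                    ≡⟨ sumCols-∷ A false ∅ ⟩
    vzero m ⊕ sumCols (λ i → A (suc i)) ∅          ≡⟨ ⊕-identityˡ _ ⟩
    sumCols (λ i → A (suc i)) ∅                    ≡⟨ sumCols-∅ (λ i → A (suc i)) ⟩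
    vzero m                                        ∎
    where open ≡-Reasoning

  sumCols-⊆∅ : ∀ {n} (A : Fin n → Vec Bool m) {Y} → Y ⊆ ∅ → sumCols A Y ≡ vzero m
  sumCols-⊆∅ A Y⊆∅ = trans (cong (sumCols A) (Empty-unique (λ (i , i∈) → ∉⊥ (Y⊆∅ i∈)))) (sumCols-∅ A)

  sumCols-remove : ∀ {n} (A : Fin n → Vec Bool m) Y x →
                   sumCols A Y ≡ lookup Y x · A x ⊕ sumCols A (Y - x)
  sumCols-remove A (b ∷ Y) zero = begin
    sumCols A (b ∷ Y)                          ≡⟨ sumCols-∷ A b Y ⟩
    b · A zero ⊕ sumCols A′ Y                  ≡⟨ cong (λ Z → b · A zero ⊕ sumCols A′ Z) (p─⊥≡p Y) ⟨
    b · A zero ⊕ sumCols A′ (Y ─ ∅)            ≡⟨ cong (b · A zero ⊕_) (⊕-identityˡ _) ⟨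
    b · A zero ⊕ vzero m ⊕ sumCols A′ (Y ─ ∅)  ≡⟨ cong (b · A zero ⊕_) (sumCols-∷ A false (Y ─ ∅)) ⟨
    b · A zero ⊕ sumCols A ((b ∷ Y) - zero)    ∎
    where open ≡-Reasoning
          A′ = λ i → A (suc i)
  sumCols-remove A (b ∷ Y) (suc x) = begin
    sumCols A (b ∷ Y)                                       ≡⟨ sumCols-∷ A b Y ⟩
    b · A zero ⊕ sumCols A′ Y                               ≡⟨ cong (b · A zero ⊕_) (sumCols-remove A′ Y x) ⟩
    b · A zero ⊕ lookup Y x · A′ x ⊕ sumCols A′ (Y - x)     ≡⟨ ⊕-assoc _ _ _ ⟨
    (b · A zero ⊕ lookup Y x · A′ x) ⊕ sumCols A′ (Y - x)   ≡⟨ cong (_⊕ sumCols A′ (Y - x)) (⊕-comm _ _) ⟩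
    (lookup Y x · A′ x ⊕ b · A zero) ⊕ sumCols A′ (Y - x)   ≡⟨ ⊕-assoc _ _ _ ⟩
    lookup Y x · A′ x ⊕ b · A zero ⊕ sumCols A′ (Y - x)     ≡⟨ cong (lookup Y x · A′ x ⊕_) (sumCols-∷ A b (Y - x)) ⟨
    lookup Y x · A′ x ⊕ sumCols A ((b ∷ Y) - suc x)         ∎
    where open ≡-Reasoning
          A′ = λ i → A (suc i)

  sumCols-⊆⁅x⁆ : ∀ {n} (A : Fin n → Vec Bool m) {Y x} → Y ⊆ ⁅ x ⁆ →
                 sumCols A Y ≡ lookup Y x · A x
  sumCols-⊆⁅x⁆ A {Y} {x} Y⊆ = begin
    sumCols A Y
      ≡⟨ sumCols-remove A Y x ⟩
    lookup Y x · A x ⊕ sumCols A (Y - x)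
      ≡⟨ cong (lookup Y x · A x ⊕_) (sumCols-⊆∅ A (q⊆⁅x⁆∪p⇒q-x⊆p (p⊆p∪q ∅ ∘ Y⊆))) ⟩
    lookup Y x · A x ⊕ vzero m
      ≡⟨ ⊕-identityʳ _ ⟩
    lookup Y x · A x
      ∎
    where open ≡-Reasoning

  sumCols-⊆⁅x⁆∪⁅y⁆ : ∀ {n} (A : Fin n → Vec Bool m) {Y x y} → x ≢ y → Y ⊆ ⁅ x ⁆ ∪ ⁅ y ⁆ →
                     sumCols A Y ≡ lookup Y x · A x ⊕ lookup Y y · A y
  sumCols-⊆⁅x⁆∪⁅y⁆ A {Y} {x} {y} x≢y Y⊆ = begin
    sumCols A Y
      ≡⟨ sumCols-remove A Y x ⟩
    lookup Y x · A x ⊕ sumCols A (Y - x)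
      ≡⟨ cong (lookup Y x · A x ⊕_) (sumCols-⊆⁅x⁆ A (q⊆⁅x⁆∪p⇒q-x⊆p Y⊆)) ⟩
    lookup Y x · A x ⊕ lookup (Y - x) y · A y
      ≡⟨ cong (λ b → lookup Y x · A x ⊕ b · A y) (lookup[p-x]≡lookup[p] Y (x≢y ∘ sym)) ⟩
    lookup Y x · A x ⊕ lookup Y y · A y
      ∎
    where open ≡-Reasoning

  sumCols-⊆⁅x⁆∪⁅y⁆∪⁅z⁆ : ∀ {n} (A : Fin n → Vec Bool m) {Y x y z} → x ≢ y → x ≢ z → y ≢ z →
                         Y ⊆ ⁅ x ⁆ ∪ ⁅ y ⁆ ∪ ⁅ z ⁆ →
                         sumCols A Y ≡ lookup Y x · A x ⊕ lookup Y y · A y ⊕ lookup Y z · A z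
  sumCols-⊆⁅x⁆∪⁅y⁆∪⁅z⁆ A {Y} {x} {y} {z} x≢y x≢z y≢z Y⊆ = begin
    sumCols A Y
      ≡⟨ sumCols-remove A Y x ⟩
    lookup Y x · A x ⊕ sumCols A (Y - x)
      ≡⟨ cong (lookup Y x · A x ⊕_) (sumCols-⊆⁅x⁆∪⁅y⁆ A y≢z (q⊆⁅x⁆∪p⇒q-x⊆p Y⊆)) ⟩
    lookup Y x · A x ⊕ lookup (Y - x) y · A y ⊕ lookup (Y - x) z · A z
      ≡⟨ cong₂ (λ b c → lookup Y x · A x ⊕ b · A y ⊕ c · A z)
               (lookup[p-x]≡lookup[p] Y (x≢y ∘ sym)) (lookup[p-x]≡lookup[p] Y (x≢z ∘ sym)) ⟩
    lookup Y x · A x ⊕ lookup Y y · A y ⊕ lookup Y z · A z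
      ∎
    where open ≡-Reasoning

module _ {n m} (A : Fin n → Vec Bool m) where

  linIndep-⊆ : ∀ {X Y} → Y ⊆ X → LinIndepGF2 A X → LinIndepGF2 A Y
  linIndep-⊆ Y⊆X indep Z Z⊆Y = indep Z (Y⊆X ∘ Z⊆Y)

  linIndep-singleton⇒≢0 : ∀ {x} → LinIndepGF2 A ⁅ x ⁆ → A x ≢ vzero m
  linIndep-singleton⇒≢0 {x} indep Ax≡0 = indep ⁅ x ⁆ ⊆-refl (x , x∈⁅x⁆ x) (begin
    sumCols A ⁅ x ⁆            ≡⟨ sumCols-⊆⁅x⁆ A ⊆-refl ⟩
    lookup ⁅ x ⁆ x · A x       ≡⟨ cong (_· A x) ([]=⇒lookup (x∈⁅x⁆ x)) ⟩
    A x                        ≡⟨ Ax≡0 ⟩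
    vzero m                    ∎)
    where open ≡-Reasoning

  linIndep-pair⇒≢ : ∀ {x y} → x ≢ y → LinIndepGF2 A (⁅ x ⁆ ∪ ⁅ y ⁆) → A x ≢ A y
  linIndep-pair⇒≢ {x} {y} x≢y indep Ax≡Ay = indep (⁅ x ⁆ ∪ ⁅ y ⁆) ⊆-refl (x , x∈⁅x⁆∪p x) (begin
    sumCols A (⁅ x ⁆ ∪ ⁅ y ⁆)  ≡⟨ sumCols-⊆⁅x⁆∪⁅y⁆ A x≢y ⊆-refl ⟩
    _ · A x ⊕ _ · A y          ≡⟨ cong₂ (λ b c → b · A x ⊕ c · A y)
                                        ([]=⇒lookup (x∈⁅x⁆∪p x)) ([]=⇒lookup (p⊆⁅x⁆∪p x (x∈⁅x⁆ y))) ⟩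
    A x ⊕ A y                  ≡⟨ cong (A x ⊕_) Ax≡Ay ⟨
    A x ⊕ A x                  ≡⟨ ⊕-self (A x) ⟩
    vzero m                    ∎)
    where open ≡-Reasoning

  linIndep-triple⇒⊕≢ : ∀ {x y z} → x ≢ y → x ≢ z → y ≢ z →
                       LinIndepGF2 A (⁅ x ⁆ ∪ ⁅ y ⁆ ∪ ⁅ z ⁆) → A x ⊕ A y ≢ A z
  linIndep-triple⇒⊕≢ {x} {y} {z} x≢y x≢z y≢z indep Ax⊕Ay≡Az =
    indep (⁅ x ⁆ ∪ ⁅ y ⁆ ∪ ⁅ z ⁆) ⊆-refl (x , x∈⁅x⁆∪p x) (begin
      sumCols A (⁅ x ⁆ ∪ ⁅ y ⁆ ∪ ⁅ z ⁆)  ≡⟨ sumCols-⊆⁅x⁆∪⁅y⁆∪⁅z⁆ A x≢y x≢z y≢z ⊆-refl ⟩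
      _ · A x ⊕ _ · A y ⊕ _ · A z        ≡⟨ cong₃ ([]=⇒lookup (x∈⁅x⁆∪p x)) ([]=⇒lookup (p⊆⁅x⁆∪p x (x∈⁅x⁆∪p y)))
                                                  ([]=⇒lookup (p⊆⁅x⁆∪p x (p⊆⁅x⁆∪p y (x∈⁅x⁆ z)))) ⟩
      A x ⊕ A y ⊕ A z                    ≡⟨ ⊕-assoc _ _ _ ⟨
      (A x ⊕ A y) ⊕ A z                  ≡⟨ cong (_⊕ A z) Ax⊕Ay≡Az ⟩
      A z ⊕ A z                          ≡⟨ ⊕-self (A z) ⟩
      vzero m                            ∎)
    where
    open ≡-Reasoning
    cong₃ : ∀ {b c d b′ c′ d′} → b ≡ b′ → c ≡ c′ → d ≡ d′ →
            b · A x ⊕ c · A y ⊕ d · A z ≡ b′ · A x ⊕ c′ · A y ⊕ d′ · A z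
    cong₃ refl refl refl = refl

  linIndep-pair : ∀ {x y} → x ≢ y → A x ≢ vzero m → A y ≢ vzero m → A x ≢ A y →
                  LinIndepGF2 A (⁅ x ⁆ ∪ ⁅ y ⁆)
  linIndep-pair {x} {y} x≢y Ax≢0 Ay≢0 Ax≢Ay Y Y⊆ (i , i∈Y) sum≡0
    with lookup Y x in Yx | lookup Y y in Yy | trans (sym (sumCols-⊆⁅x⁆∪⁅y⁆ A x≢y Y⊆)) sum≡0
  ... | true  | true  | eq = Ax≢Ay (⊕≡0⇒≡ eq)
  ... | true  | false | eq = Ax≢0 (trans (sym (⊕-identityʳ _)) eq)
  ... | false | true  | eq = Ay≢0 (trans (sym (⊕-identityˡ _)) eq)
  ... | false | false | _ with ∈⁅x⁆∪⁅y⁆⁻ (Y⊆ i∈Y)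
  ...   | inj₁ refl = lookup≡false⇒∉ Yx i∈Y
  ...   | inj₂ refl = lookup≡false⇒∉ Yy i∈Y

  linIndep-triple : ∀ {x y z} → x ≢ y → x ≢ z → y ≢ z →
                    A x ≢ vzero m → A y ≢ vzero m → A z ≢ vzero m →
                    A x ≢ A y → A x ≢ A z → A y ≢ A z → A x ⊕ A y ≢ A z →
                    LinIndepGF2 A (⁅ x ⁆ ∪ ⁅ y ⁆ ∪ ⁅ z ⁆)
  linIndep-triple {x} {y} {z} x≢y x≢z y≢z Ax≢0 Ay≢0 Az≢0 Ax≢Ay Ax≢Az Ay≢Az Ax⊕Ay≢Az Y Y⊆ (i , i∈Y) sum≡0
    with lookup Y x in Yx | lookup Y y in Yy | lookup Y z in Yz
       | trans (sym (sumCols-⊆⁅x⁆∪⁅y⁆∪⁅z⁆ A x≢y x≢z y≢z Y⊆)) sum≡0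
  ... | true  | true  | true  | eq = Ax⊕Ay≢Az (⊕≡0⇒≡ (trans (⊕-assoc _ _ _) eq))
  ... | true  | true  | false | eq = Ax≢Ay (⊕≡0⇒≡ (trans (cong (A x ⊕_) (sym (⊕-identityʳ _))) eq))
  ... | true  | false | true  | eq = Ax≢Az (⊕≡0⇒≡ (trans (cong (A x ⊕_) (sym (⊕-identityˡ _))) eq))
  ... | true  | false | false | eq = Ax≢0 (trans (sym (trans (cong (A x ⊕_) (⊕-identityˡ _)) (⊕-identityʳ _))) eq)
  ... | false | true  | true  | eq = Ay≢Az (⊕≡0⇒≡ (trans (sym (⊕-identityˡ _)) eq))
  ... | false | true  | false | eq = Ay≢0 (trans (sym (trans (⊕-identityˡ _) (⊕-identityʳ _))) eq)
  ... | false | false | true  | eq = Az≢0 (trans (sym (trans (⊕-identityˡ _) (⊕-identityˡ _))) eq)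
  ... | false | false | false | _ with ∈⁅x⁆∪⁅y⁆∪⁅z⁆⁻ (Y⊆ i∈Y)
  ...   | inj₁ refl        = lookup≡false⇒∉ Yx i∈Y
  ...   | inj₂ (inj₁ refl) = lookup≡false⇒∉ Yy i∈Y
  ...   | inj₂ (inj₂ refl) = lookup≡false⇒∉ Yz i∈Y

Fin-injective⇒surjective : ∀ {n} {f : Fin n → Fin n} → Injective _≡_ _≡_ f → ∀ k → ∃ λ i → f i ≡ k
Fin-injective⇒surjective {suc n} {f} f-inj k with any? (λ i → f i ≟ k)
... | yes hit = hit
... | no miss = ⊥-elim (<-irrefl refl (injective⇒≤ punchOut∘f-injective))
  where
  k≢f : ∀ i → k ≢ f i
  k≢f i k≡fi = miss (i , sym k≡fi)
  punchOut∘f-injective : Injective _≡_ _≡_ (λ i → punchOut (k≢f i))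
  punchOut∘f-injective eq = f-inj (punchOut-injective (k≢f _) (k≢f _) eq)

Fin-another : ∀ {n} (i : Fin (suc (suc n))) → ∃ λ j → i ≢ j
Fin-another zero    = suc zero , λ ()
Fin-another (suc i) = zero , λ ()

module _ {A : Set} {a b p q : A} where

  ≢-in-pair : a ≢ b → a ≡ p ⊎ a ≡ q → b ≡ p ⊎ b ≡ q → (a ≡ p × b ≡ q) ⊎ (a ≡ q × b ≡ p)
  ≢-in-pair a≢b (inj₁ refl) (inj₁ refl) = ⊥-elim (a≢b refl)
  ≢-in-pair a≢b (inj₁ a≡p)  (inj₂ b≡q)  = inj₁ (a≡p , b≡q)
  ≢-in-pair a≢b (inj₂ a≡q)  (inj₁ b≡p)  = inj₂ (a≡q , b≡p)
  ≢-in-pair a≢b (inj₂ refl) (inj₂ refl) = ⊥-elim (a≢b refl)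

module _ {A : Set} {a b c p q : A} where

  ¬three-in-pair : a ≢ b → a ≢ c → b ≢ c → a ≡ p ⊎ a ≡ q → b ≡ p ⊎ b ≡ q → ¬ (c ≡ p ⊎ c ≡ q)
  ¬three-in-pair a≢b _   _   (inj₁ refl) (inj₁ refl) _           = a≢b refl
  ¬three-in-pair a≢b _   _   (inj₂ refl) (inj₂ refl) _           = a≢b refl
  ¬three-in-pair _   a≢c _   (inj₁ refl) _           (inj₁ refl) = a≢c refl
  ¬three-in-pair _   a≢c _   (inj₂ refl) _           (inj₂ refl) = a≢c refl
  ¬three-in-pair _   _   b≢c _           (inj₁ refl) (inj₁ refl) = b≢c refl
  ¬three-in-pair _   _   b≢c _           (inj₂ refl) (inj₂ refl) = b≢c refl

module _ {n} {E : Subset n} {I : Subset n → Set} where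

  IsParallel⇒independent : ∀ {e e′} → IsParallel E I e e′ → I ⁅ e ⁆
  IsParallel⇒independent {e} {e′} (e≢e′ , _ , _ , proper-indep) =
    proper-indep ⁅ e ⁆ (p⊆p∪q _ , e′ , p⊆⁅x⁆∪p e (x∈⁅x⁆ e′) , e′∉⁅e⁆)
    where e′∉⁅e⁆ = λ e′∈ → e≢e′ (sym (x∈⁅y⁆⇒x≡y e e′∈))

  IsCocircuit-meets-basis : ∀ {C B} → IsCocircuit E I C → IsBasis E I B → ¬ Empty (C ∩ B)
  IsCocircuit-meets-basis (C⊆E , C-codependent , _) B-basis C∩B-empty =
    C-codependent (C⊆E , _ , B-basis , C∩B-empty)

module _ {n} (M : Matroid n) where

  ∣indep∣≤∣basis∣ : ∀ {B X} → IsBasis full (Indep M) B → Indep M X → ∣ X ∣ ≤ ∣ B ∣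
  ∣indep∣≤∣basis∣ {B} {X} (_ , B-indep , B-maximal) X-indep with ∣ X ∣ ≤? ∣ B ∣
  ... | yes ∣X∣≤∣B∣ = ∣X∣≤∣B∣
  ... | no ∣X∣≰∣B∣ with augment M B X B-indep X-indep (≰⇒> ∣X∣≰∣B∣)
  ...   | e , _ , e∉B , B∪e-indep =
    ⊥-elim (e∉B (subst (e ∈_) (B-maximal _ (λ _ → ∈⊤) (p⊆p∪q _) B∪e-indep) (q⊆p∪q B _ (x∈⁅x⁆ e))))

  dependent⇒loop : ∀ {x} → ¬ Indep M ⁅ x ⁆ → IsLoop full (Indep M) x
  dependent⇒loop {x} ⁅x⁆-dependent = (λ _ → ∈⊤) , ⁅x⁆-dependent , proper-indep
    where
    proper-indep : ∀ D → D ⊂ ⁅ x ⁆ → Indep M D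
    proper-indep D (D⊆⁅x⁆ , y , y∈⁅x⁆ , y∉D) = indep-⊆ M D ∅ D⊆∅ (indep-∅ M)
      where
      D⊆∅ : D ⊆ ∅
      D⊆∅ i∈D = ⊥-elim (y∉D (subst (_∈ D) i≡y i∈D))
        where i≡y = trans (x∈⁅y⁆⇒x≡y x (D⊆⁅x⁆ i∈D)) (sym (x∈⁅y⁆⇒x≡y x y∈⁅x⁆))

-- The graph F

pattern f0 = zero
pattern f1 = suc zero
pattern f2 = suc (suc zero)
pattern f3 = suc (suc (suc zero))
pattern f4 = suc (suc (suc (suc zero)))

injective? : ∀ {k l} (f : Fin k → Fin l) → Dec (∀ x y → f x ≡ f y → x ≡ y)
injective? f = all? λ x → all? λ y → (f x ≟ f y) →-dec (x ≟ y)

joins? : ∀ e x y → Dec (Joins F e x y)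
joins? e x y = (F e ≟₂ (x , y)) ⊎-dec (F e ≟₂ (y , x))
  where _≟₂_ = ≡-dec₂ _≟_ _≟_

mkCycle : ∀ {l} (vs : Vec (Fin 3) (suc l)) (es : Vec (Fin 5) (suc l)) →
          {True (injective? (lookup vs))} → {True (injective? (lookup es))} →
          {True (all? λ i → joins? (lookup es i) (lookup vs i) (lookup vs (next i)))} → Cycle F
mkCycle vs es {vs-inj} {es-inj} {vs-es} = record
  { len       = _
  ; verts     = lookup vs
  ; edges     = lookup es
  ; verts-inj = λ {x} {y} → toWitness vs-inj x y
  ; edges-inj = λ {x} {y} → toWitness es-inj x y
  ; joins     = toWitness vs-es
  }

Cycle-edges-distinct : ∀ {k m} {G : Graph k m} (c : Cycle G) {i j} → i ≢ j → Cycle.edges c i ≢ Cycle.edges c j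
Cycle-edges-distinct c i≢j = i≢j ∘ Cycle.edges-inj c

parallelClass : Fin 5 → Fin 3
parallelClass f0 = f0
parallelClass f1 = f0
parallelClass f2 = f1
parallelClass f3 = f1
parallelClass f4 = f2

classRep : Fin 3 → Fin 5
classRep f0 = f0
classRep f1 = f2
classRep f2 = f4

parallelClass-classRep : ∀ r → parallelClass (classRep r) ≡ r
parallelClass-classRep f0 = refl
parallelClass-classRep f1 = refl
parallelClass-classRep f2 = refl

F-loopless : ∀ e x → ¬ Joins F e x x
F-loopless = from-yes (all? λ e → all? λ x → ¬? (joins? e x x))

joins-same⇒parallelClass≡ : ∀ e e′ x y → Joins F e x y → Joins F e′ x y → parallelClass e ≡ parallelClass e′
joins-same⇒parallelClass≡ = from-yes (all? λ e → all? λ e′ → all? λ x → all? λ y →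
  joins? e x y →-dec (joins? e′ x y →-dec (parallelClass e ≟ parallelClass e′)))

parallelClass-fibres-≤2 : ∀ k₁ k₂ k₃ →
                          parallelClass k₁ ≡ parallelClass k₂ → parallelClass k₁ ≡ parallelClass k₃ →
                          k₁ ≡ k₂ ⊎ k₁ ≡ k₃ ⊎ k₂ ≡ k₃
parallelClass-fibres-≤2 = from-yes (all? λ k₁ → all? λ k₂ → all? λ k₃ →
  (parallelClass k₁ ≟ parallelClass k₂) →-dec ((parallelClass k₁ ≟ parallelClass k₃) →-dec
  ((k₁ ≟ k₂) ⊎-dec (k₁ ≟ k₃) ⊎-dec (k₂ ≟ k₃))))

three-edges-outside-class : ∀ r → ∃ λ k₁ → ∃ λ k₂ → ∃ λ k₃ → (k₁ ≢ k₂ × k₁ ≢ k₃ × k₂ ≢ k₃) ×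
                            (parallelClass k₁ ≢ r × parallelClass k₂ ≢ r × parallelClass k₃ ≢ r)
three-edges-outside-class = from-yes (all? λ r → any? λ k₁ → any? λ k₂ → any? λ k₃ →
  (¬? (k₁ ≟ k₂) ×-dec ¬? (k₁ ≟ k₃) ×-dec ¬? (k₂ ≟ k₃)) ×-dec
  (¬? (parallelClass k₁ ≟ r) ×-dec ¬? (parallelClass k₂ ≟ r) ×-dec ¬? (parallelClass k₃ ≟ r)))

uv-digon : Cycle F
uv-digon = mkCycle (f0 ∷ f1 ∷ []) (f0 ∷ f1 ∷ [])

uw-digon : Cycle F
uw-digon = mkCycle (f0 ∷ f2 ∷ []) (f2 ∷ f3 ∷ [])

uvw-triangle : Cycle F
uvw-triangle = mkCycle (f0 ∷ f1 ∷ f2 ∷ []) (f0 ∷ f4 ∷ f2 ∷ [])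

another-class : ∀ k → ∃ λ k′ → parallelClass k ≢ parallelClass k′
another-class = from-yes (all? λ k → any? λ k′ → ¬? (parallelClass k ≟ parallelClass k′))

no-cycle-in-pair : ∀ {p q} → parallelClass p ≢ parallelClass q → (c : Cycle F) →
                   ¬ (∀ i → Cycle.edges c i ≡ p ⊎ Cycle.edges c i ≡ q)
no-cycle-in-pair _ record { len = zero ; joins = joins } _ = F-loopless _ _ (joins f0)
no-cycle-in-pair p≁q c@record { len = suc zero ; joins = joins } e∈
  with joins-same⇒parallelClass≡ _ _ _ _ (joins f0) (swap (joins f1))
     | ≢-in-pair (Cycle-edges-distinct c {f0} {f1} (λ ())) (e∈ f0) (e∈ f1)
... | same-class | inj₁ (refl , refl) = p≁q same-class
... | same-class | inj₂ (refl , refl) = p≁q (sym same-class)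
no-cycle-in-pair _ c@record { len = suc (suc _) } e∈ =
  ¬three-in-pair (distinct {f0} {f1} (λ ())) (distinct {f0} {f2} (λ ())) (distinct {f1} {f2} (λ ()))
                 (e∈ f0) (e∈ f1) (e∈ f2)
  where distinct = Cycle-edges-distinct c

-- Q as a binary single-element extension of M(F)

module BinaryExtensionOfMF
  {n} (Q : Matroid n) (a : Fin n) {m} (A : Fin n → Vec Bool m)
  (A-represents : ∀ X → (Indep Q X → LinIndepGF2 A X) × (LinIndepGF2 A X → Indep Q X))
  (a-nonloop : ¬ IsLoop full (Indep Q) a) (a-noncoloop : ¬ IsColoop full (Indep Q) a)
  (φ : Fin 5 → Fin n) (φ-injective : Injective _≡_ _≡_ φ) (φ≢a : ∀ k → φ k ≢ a)
  (φ-onto : ∀ e → e ≢ a → ∃ λ k → φ k ≡ e)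
  (φ-iso : ∀ X → X ⊆ minorGround a →
             (DelIndep Q a X → CycleIndep F (preimage φ X)) ×
             (CycleIndep F (preimage φ X) → DelIndep Q a X))
  where

  E : Subset n
  E = minorGround a

  CI : Subset n → Set
  CI = ConIndep Q a

  indep⇒linIndep : ∀ {X} → Indep Q X → LinIndepGF2 A X
  indep⇒linIndep = proj₁ (A-represents _)

  linIndep⇒indep : ∀ {X} → LinIndepGF2 A X → Indep Q X
  linIndep⇒indep = proj₂ (A-represents _)

  infix 4 _≟ᵥ_
  _≟ᵥ_ : (u v : Vec Bool m) → Dec (u ≡ v)
  _≟ᵥ_ = ≡-decᵥ _≟ᵇ_

  ≢a⇒∈E : ∀ {e} → e ≢ a → e ∈ E
  ≢a⇒∈E e≢a = x∉p⇒x∈∁p (e≢a ∘ x∈⁅y⁆⇒x≡y a)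

  ∈E⇒≢a : ∀ {e} → e ∈ E → e ≢ a
  ∈E⇒≢a e∈E refl = x∈∁p⇒x∉p e∈E (x∈⁅x⁆ a)

  φ-distinct : ∀ {k k′} → k ≢ k′ → φ k ≢ φ k′
  φ-distinct k≢k′ = k≢k′ ∘ φ-injective

  φ∈E : ∀ k → φ k ∈ E
  φ∈E k = ≢a⇒∈E (φ≢a k)

  cycle⇒dependent : ∀ {X} → X ⊆ E → (c : Cycle F) → (∀ i → φ (Cycle.edges c i) ∈ X) → ¬ Indep Q X
  cycle⇒dependent {X} X⊆E c c⊆X X-indep = proj₁ (φ-iso X X⊆E) (X⊆E , X-indep) (c , ∈preimage⁺ φ ∘ c⊆X)

  independent-pair : ∀ {p q} → parallelClass p ≢ parallelClass q → Indep Q (⁅ φ p ⁆ ∪ ⁅ φ q ⁆)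
  independent-pair {p} {q} p≁q = proj₂ (proj₂ (φ-iso _ pair⊆E) acyclic)
    where
    pair⊆E = ⁅x⁆∪p⊆q (φ∈E p) (⁅x⁆⊆p (φ∈E q))
    acyclic : CycleIndep F (preimage φ (⁅ φ p ⁆ ∪ ⁅ φ q ⁆))
    acyclic (c , c⊆) = no-cycle-in-pair p≁q c λ i →
      Sum.map φ-injective φ-injective (∈⁅x⁆∪⁅y⁆⁻ (∈preimage⁻ φ (c⊆ i)))

  column : Fin 5 → Vec Bool m
  column k = A (φ k)

  column≢0 : ∀ k → column k ≢ vzero m
  column≢0 k with another-class k
  ... | _ , k≁k′ = linIndep-singleton⇒≢0 A (linIndep-⊆ A (p⊆p∪q _) (indep⇒linIndep (independent-pair k≁k′)))

  column-distinct : ∀ {p q} → parallelClass p ≢ parallelClass q → column p ≢ column q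
  column-distinct p≁q =
    linIndep-pair⇒≢ A (φ-distinct (p≁q ∘ cong parallelClass)) (indep⇒linIndep (independent-pair p≁q))

  cycle-in-pair⇒columns≡ : ∀ {p q} → p ≢ q → (c : Cycle F) →
                           (∀ i → φ (Cycle.edges c i) ∈ ⁅ φ p ⁆ ∪ ⁅ φ q ⁆) → column p ≡ column q
  cycle-in-pair⇒columns≡ {p} {q} p≢q c c⊆ = decidable-stable (column p ≟ᵥ column q) λ columns≢ →
    cycle⇒dependent (⁅x⁆∪p⊆q (φ∈E p) (⁅x⁆⊆p (φ∈E q))) c c⊆
      (linIndep⇒indep (linIndep-pair A (φ-distinct p≢q) (column≢0 p) (column≢0 q) columns≢))

  uv-columns : column f0 ≡ column f1
  uv-columns = cycle-in-pair⇒columns≡ (λ ()) uv-digon λ { f0 → x∈⁅x⁆∪p _ ; f1 → p⊆⁅x⁆∪p _ (x∈⁅x⁆ _) }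

  uw-columns : column f2 ≡ column f3
  uw-columns = cycle-in-pair⇒columns≡ (λ ()) uw-digon λ { f0 → x∈⁅x⁆∪p _ ; f1 → p⊆⁅x⁆∪p _ (x∈⁅x⁆ _) }

  triangle-columns : column f0 ⊕ column f2 ≡ column f4
  triangle-columns = decidable-stable (column f0 ⊕ column f2 ≟ᵥ column f4) λ sum≢ →
    cycle⇒dependent triangle⊆E uvw-triangle triangle-edges
      (linIndep⇒indep (linIndep-triple A (φ-distinct (λ ())) (φ-distinct (λ ())) (φ-distinct (λ ()))
        (column≢0 f0) (column≢0 f2) (column≢0 f4)
        (column-distinct (λ ())) (column-distinct (λ ())) (column-distinct (λ ())) sum≢))
    where
    triangle⊆E = ⁅x⁆∪p⊆q (φ∈E f0) (⁅x⁆∪p⊆q (φ∈E f2) (⁅x⁆⊆p (φ∈E f4)))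
    triangle-edges : ∀ i → φ (Cycle.edges uvw-triangle i) ∈ ⁅ φ f0 ⁆ ∪ ⁅ φ f2 ⁆ ∪ ⁅ φ f4 ⁆
    triangle-edges f0 = x∈⁅x⁆∪p _
    triangle-edges f1 = p⊆⁅x⁆∪p _ (p⊆⁅x⁆∪p _ (x∈⁅x⁆ _))
    triangle-edges f2 = p⊆⁅x⁆∪p _ (x∈⁅x⁆∪p _)

  classColumn : Fin 3 → Vec Bool m
  classColumn r = column (classRep r)

  column≡classColumn : ∀ k → column k ≡ classColumn (parallelClass k)
  column≡classColumn f0 = refl
  column≡classColumn f1 = sym uv-columns
  column≡classColumn f2 = refl
  column≡classColumn f3 = sym uw-columns
  column≡classColumn f4 = refl

  classColumn-injective : ∀ {r s} → classColumn r ≡ classColumn s → r ≡ s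
  classColumn-injective {r} {s} eq = decidable-stable (r ≟ s) λ r≢s →
    column-distinct (λ same → r≢s (trans (sym (parallelClass-classRep r)) (trans same (parallelClass-classRep s)))) eq

  classColumn-⊕ : ∀ {r s t} → r ≢ s → r ≢ t → s ≢ t → classColumn r ⊕ classColumn s ≡ classColumn t
  classColumn-⊕ {f0} {f1} {f2} _ _ _ = triangle-columns
  classColumn-⊕ {f1} {f0} {f2} _ _ _ = trans (⊕-comm _ _) triangle-columns
  classColumn-⊕ {f0} {f2} {f1} _ _ _ = ⊕-swap triangle-columns
  classColumn-⊕ {f2} {f0} {f1} _ _ _ = trans (⊕-comm _ _) (⊕-swap triangle-columns)
  classColumn-⊕ {f1} {f2} {f0} _ _ _ = ⊕-swap (trans (⊕-comm _ _) triangle-columns)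
  classColumn-⊕ {f2} {f1} {f0} _ _ _ = trans (⊕-comm _ _) (⊕-swap (trans (⊕-comm _ _) triangle-columns))
  classColumn-⊕ {f0} {f0} r≢s _ _ = ⊥-elim (r≢s refl)
  classColumn-⊕ {f1} {f1} r≢s _ _ = ⊥-elim (r≢s refl)
  classColumn-⊕ {f2} {f2} r≢s _ _ = ⊥-elim (r≢s refl)
  classColumn-⊕ {f0} {_} {f0} _ r≢t _ = ⊥-elim (r≢t refl)
  classColumn-⊕ {f1} {_} {f1} _ r≢t _ = ⊥-elim (r≢t refl)
  classColumn-⊕ {f2} {_} {f2} _ r≢t _ = ⊥-elim (r≢t refl)
  classColumn-⊕ {_} {f0} {f0} _ _ s≢t = ⊥-elim (s≢t refl)
  classColumn-⊕ {_} {f1} {f1} _ _ s≢t = ⊥-elim (s≢t refl)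
  classColumn-⊕ {_} {f2} {f2} _ _ s≢t = ⊥-elim (s≢t refl)

  HasClassColumn : Fin n → Set
  HasClassColumn e = ∃ λ r → A e ≡ classColumn r

  ≢a⇒HasClassColumn : ∀ {e} → e ≢ a → HasClassColumn e
  ≢a⇒HasClassColumn {e} e≢a with φ-onto e e≢a
  ... | k , refl = parallelClass k , column≡classColumn k

  HasClassColumn⇒≢0 : ∀ {e} → HasClassColumn e → A e ≢ vzero m
  HasClassColumn⇒≢0 (r , Ae≡r) = column≢0 (classRep r) ∘ trans (sym Ae≡r)

  no-independent-triple : ∀ {x y z} → x ≢ y → x ≢ z → y ≢ z →
                          HasClassColumn x → HasClassColumn y → HasClassColumn z →
                          ¬ LinIndepGF2 A (⁅ x ⁆ ∪ ⁅ y ⁆ ∪ ⁅ z ⁆)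
  no-independent-triple {x} {y} {z} x≢y x≢z y≢z (r , Ax) (s , Ay) (t , Az) indep = by-classes (r ≟ s) (r ≟ t) (s ≟ t)
    where
    x∈ = x∈⁅x⁆∪p x
    y∈ = p⊆⁅x⁆∪p x (x∈⁅x⁆∪p y)
    z∈ = p⊆⁅x⁆∪p x (p⊆⁅x⁆∪p y (x∈⁅x⁆ z))
    by-classes : Dec (r ≡ s) → Dec (r ≡ t) → Dec (s ≡ t) → ⊥
    by-classes (yes r≡s) _ _ = linIndep-pair⇒≢ A x≢y (linIndep-⊆ A (⁅x⁆∪p⊆q x∈ (⁅x⁆⊆p y∈)) indep)
                                 (trans Ax (trans (cong classColumn r≡s) (sym Ay)))
    by-classes _ (yes r≡t) _ = linIndep-pair⇒≢ A x≢z (linIndep-⊆ A (⁅x⁆∪p⊆q x∈ (⁅x⁆⊆p z∈)) indep)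
                                 (trans Ax (trans (cong classColumn r≡t) (sym Az)))
    by-classes _ _ (yes s≡t) = linIndep-pair⇒≢ A y≢z (linIndep-⊆ A (⁅x⁆∪p⊆q y∈ (⁅x⁆⊆p z∈)) indep)
                                 (trans Ay (trans (cong classColumn s≡t) (sym Az)))
    by-classes (no r≢s) (no r≢t) (no s≢t) = linIndep-triple⇒⊕≢ A x≢y x≢z y≢z indep
      (trans (cong₂ _⊕_ Ax Ay) (trans (classColumn-⊕ r≢s r≢t s≢t) (sym Az)))

  ∣indep-avoiding-a∣≤2 : ∀ {X} → Indep Q X → a ∉ X → ∣ X ∣ ≤ 2
  ∣indep-avoiding-a∣≤2 {X} X-indep a∉X with ∣ X ∣ ≤? 2
  ... | yes ∣X∣≤2 = ∣X∣≤2
  ... | no ∣X∣≰2 with augment Q P X (independent-pair (λ ())) X-indep (subst (_< ∣ X ∣) (sym ∣P∣≡2) (≰⇒> ∣X∣≰2))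
    where
    P = ⁅ φ f0 ⁆ ∪ ⁅ φ f2 ⁆
    ∣P∣≡2 = ∣⁅x⁆∪⁅y⁆∣≡2 (φ-distinct {f0} {f2} (λ ()))
  ...   | e , e∈X , e∉P , P∪e-indep =
    ⊥-elim (no-independent-triple (φ-distinct (λ ())) φ0≢e φ2≢e
              (≢a⇒HasClassColumn (φ≢a f0)) (≢a⇒HasClassColumn (φ≢a f2)) (≢a⇒HasClassColumn e≢a)
              (subst (LinIndepGF2 A) (∪-assoc _ _ _) (indep⇒linIndep P∪e-indep)))
    where
    e≢a : e ≢ a
    e≢a refl = a∉X e∈X
    φ0≢e : φ f0 ≢ e
    φ0≢e refl = e∉P (x∈⁅x⁆∪p _)
    φ2≢e : φ f2 ≢ e
    φ2≢e refl = e∉P (p⊆⁅x⁆∪p _ (x∈⁅x⁆ _))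

  a-column≢0 : A a ≢ vzero m
  a-column≢0 Aa≡0 = a-nonloop (dependent⇒loop Q λ ⁅a⁆-indep →
    linIndep-singleton⇒≢0 A (indep⇒linIndep ⁅a⁆-indep) Aa≡0)

  a-HasClassColumn : HasClassColumn a
  a-HasClassColumn with any? (λ r → A a ≟ᵥ classColumn r)
  ... | yes found = found
  ... | no none = ⊥-elim (a-noncoloop (∈⊤ , a∈basis))
    where
    Aa≢ : ∀ r → A a ≢ classColumn r
    Aa≢ r Aa≡r = none (r , Aa≡r)
    T = ⁅ φ f0 ⁆ ∪ ⁅ φ f2 ⁆ ∪ ⁅ a ⁆
    T-indep : Indep Q T
    T-indep = linIndep⇒indep (linIndep-triple A (φ-distinct (λ ())) (φ≢a f0) (φ≢a f2)
      (column≢0 f0) (column≢0 f2) a-column≢0 (column-distinct (λ ())) (Aa≢ f0 ∘ sym) (Aa≢ f1 ∘ sym)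
      (λ sum≡Aa → Aa≢ f2 (trans (sym sum≡Aa) triangle-columns)))
    ∣T∣≡3 : ∣ T ∣ ≡ 3
    ∣T∣≡3 = ∣⁅x⁆∪⁅y⁆∪⁅z⁆∣≡3 (φ-distinct (λ ())) (φ≢a f0) (φ≢a f2)
    a∈basis : ∀ B → IsBasis full (Indep Q) B → a ∈ B
    a∈basis B B-basis@(_ , B-indep , _) = decidable-stable (a ∈? B) λ a∉B → <-irrefl refl (begin
      3      ≡⟨ ∣T∣≡3 ⟨
      ∣ T ∣  ≤⟨ ∣indep∣≤∣basis∣ Q B-basis T-indep ⟩
      ∣ B ∣  ≤⟨ ∣indep-avoiding-a∣≤2 B-indep a∉B ⟩
      2      ∎)
      where open ≤-Reasoning

  conIndep⁅e⁆⇒column≢ : ∀ {e} → e ≢ a → CI ⁅ e ⁆ → A e ≢ A a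
  conIndep⁅e⁆⇒column≢ e≢a (_ , e∪a-indep) = linIndep-pair⇒≢ A e≢a (indep⇒linIndep e∪a-indep)

  column≢⇒conIndep⁅e⁆ : ∀ {e} → e ≢ a → A e ≢ A a → CI ⁅ e ⁆
  column≢⇒conIndep⁅e⁆ e≢a Ae≢Aa = ⁅x⁆⊆p (≢a⇒∈E e≢a) ,
    linIndep⇒indep (linIndep-pair A e≢a (HasClassColumn⇒≢0 (≢a⇒HasClassColumn e≢a)) a-column≢0 Ae≢Aa)

  contraction-loop⇒column≡ : ∀ {e} → IsLoop E CI e → e ≢ a × A e ≡ A a
  contraction-loop⇒column≡ {e} (⁅e⁆⊆E , ⁅e⁆-dependent , _) =
    e≢a , decidable-stable (A e ≟ᵥ A a) (⁅e⁆-dependent ∘ column≢⇒conIndep⁅e⁆ e≢a)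
    where e≢a = ∈E⇒≢a (⁅e⁆⊆E (x∈⁅x⁆ e))

  contraction-singleton-basis : ∀ {e} → e ≢ a → A e ≢ A a → IsBasis E CI ⁅ e ⁆
  contraction-singleton-basis {e} e≢a Ae≢Aa = ⁅x⁆⊆p (≢a⇒∈E e≢a) , column≢⇒conIndep⁅e⁆ e≢a Ae≢Aa , maximal
    where
    maximal : ∀ Y → Y ⊆ E → ⁅ e ⁆ ⊆ Y → CI Y → Y ≡ ⁅ e ⁆
    maximal Y Y⊆E ⁅e⁆⊆Y (_ , Y∪a-indep) = ⊆-antisym Y⊆⁅e⁆ ⁅e⁆⊆Y
      where
      Y⊆⁅e⁆ : Y ⊆ ⁅ e ⁆
      Y⊆⁅e⁆ {i} i∈Y = decidable-stable (i ∈? ⁅ e ⁆) λ i∉⁅e⁆ →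
        no-independent-triple (λ e≡i → i∉⁅e⁆ (subst (_∈ ⁅ e ⁆) e≡i (x∈⁅x⁆ e))) e≢a i≢a
          (≢a⇒HasClassColumn e≢a) (≢a⇒HasClassColumn i≢a) a-HasClassColumn
          (linIndep-⊆ A triple⊆Y∪a (indep⇒linIndep Y∪a-indep))
        where
        i≢a = ∈E⇒≢a (Y⊆E i∈Y)
        triple⊆Y∪a : ⁅ e ⁆ ∪ ⁅ i ⁆ ∪ ⁅ a ⁆ ⊆ Y ∪ ⁅ a ⁆
        triple⊆Y∪a = ⁅x⁆∪p⊆q (p⊆p∪q _ (⁅e⁆⊆Y (x∈⁅x⁆ e)))
                       (⁅x⁆∪p⊆q (p⊆p∪q _ i∈Y) (⁅x⁆⊆p (q⊆p∪q Y _ (x∈⁅x⁆ a))))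

  sameColumn⇒sameClass : ∀ {k k′} → column k ≡ column k′ → parallelClass k ≡ parallelClass k′
  sameColumn⇒sameClass {k} {k′} eq =
    classColumn-injective (trans (sym (column≡classColumn k)) (trans eq (column≡classColumn k′)))

  contraction-no-three-loops : ∀ e₁ e₂ e₃ → e₁ ≢ e₂ → e₁ ≢ e₃ → e₂ ≢ e₃ →
                               ¬ (IsLoop E CI e₁ × IsLoop E CI e₂ × IsLoop E CI e₃)
  contraction-no-three-loops e₁ e₂ e₃ e₁≢e₂ e₁≢e₃ e₂≢e₃ (loop₁ , loop₂ , loop₃)
    with contraction-loop⇒column≡ loop₁ | contraction-loop⇒column≡ loop₂ | contraction-loop⇒column≡ loop₃
  ... | e₁≢a , A₁ | e₂≢a , A₂ | e₃≢a , A₃ with φ-onto e₁ e₁≢a | φ-onto e₂ e₂≢a | φ-onto e₃ e₃≢a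
  ... | k₁ , refl | k₂ , refl | k₃ , refl
    with parallelClass-fibres-≤2 k₁ k₂ k₃ (sameColumn⇒sameClass (trans A₁ (sym A₂)))
                                          (sameColumn⇒sameClass (trans A₁ (sym A₃)))
  ... | inj₁ refl        = e₁≢e₂ refl
  ... | inj₂ (inj₁ refl) = e₁≢e₃ refl
  ... | inj₂ (inj₂ refl) = e₂≢e₃ refl

  contraction-no-cocircuit-of-size-2 : ∀ C → ∣ C ∣ ≡ 2 → ¬ IsCocircuit E CI C
  contraction-no-cocircuit-of-size-2 C ∣C∣≡2 C-cocircuit with a-HasClassColumn
  ... | r , Aa≡r with three-edges-outside-class r
  ...   | k₁ , k₂ , k₃ , (k₁≢k₂ , k₁≢k₃ , k₂≢k₃) , (k₁≁r , k₂≁r , k₃≁r) =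
    <-irrefl refl (begin
      3      ≡⟨ ∣⁅x⁆∪⁅y⁆∪⁅z⁆∣≡3 (φ-distinct k₁≢k₂) (φ-distinct k₁≢k₃) (φ-distinct k₂≢k₃) ⟨
      ∣ T ∣  ≤⟨ p⊆q⇒∣p∣≤∣q∣ T⊆C ⟩
      ∣ C ∣  ≡⟨ ∣C∣≡2 ⟩
      2      ∎)
    where
    open ≤-Reasoning
    T = ⁅ φ k₁ ⁆ ∪ ⁅ φ k₂ ⁆ ∪ ⁅ φ k₃ ⁆
    ∈C : ∀ {k} → parallelClass k ≢ r → φ k ∈ C
    ∈C {k} k≁r = decidable-stable (φ k ∈? C) λ φk∉C →
      IsCocircuit-meets-basis C-cocircuit (contraction-singleton-basis (φ≢a k) Aφk≢Aa) (x∉p⇒Empty[p∩⁅x⁆] φk∉C)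
      where
      Aφk≢Aa : A (φ k) ≢ A a
      Aφk≢Aa eq = k≁r (classColumn-injective (trans (sym (column≡classColumn k)) (trans eq Aa≡r)))
    T⊆C : T ⊆ C
    T⊆C = ⁅x⁆∪p⊆q (∈C k₁≁r) (⁅x⁆∪p⊆q (∈C k₂≁r) (⁅x⁆⊆p (∈C k₃≁r)))

  contraction-no-five-parallel : ∀ (f : Fin 5 → Fin n) → ¬ (∀ i j → i ≢ j → IsParallel E CI (f i) (f j))
  contraction-no-five-parallel f parallel = hit (Fin-injective⇒surjective index-injective (classRep r))
    where
    open ≡-Reasoning
    r = proj₁ a-HasClassColumn
    partner : ∀ i → IsParallel E CI (f i) (f (proj₁ (Fin-another i)))
    partner i = parallel i _ (proj₂ (Fin-another i))
    f≢a : ∀ i → f i ≢ a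
    f≢a i = ∈E⇒≢a (proj₁ (proj₂ (partner i)) (x∈⁅x⁆∪p (f i)))
    index : Fin 5 → Fin 5
    index i = proj₁ (φ-onto (f i) (f≢a i))
    φ-index : ∀ i → φ (index i) ≡ f i
    φ-index i = proj₂ (φ-onto (f i) (f≢a i))
    index-injective : Injective _≡_ _≡_ index
    index-injective {i} {j} eq = decidable-stable (i ≟ j) λ i≢j →
      proj₁ (parallel i j i≢j) (trans (sym (φ-index i)) (trans (cong φ eq) (φ-index j)))
    hit : (∃ λ i → index i ≡ classRep r) → ⊥
    hit (i , index≡rep) = conIndep⁅e⁆⇒column≢ (f≢a i) (IsParallel⇒independent (partner i)) (begin
      A (f i)            ≡⟨ cong A (φ-index i) ⟨
      column (index i)   ≡⟨ cong column index≡rep ⟩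
      classColumn r      ≡⟨ proj₂ a-HasClassColumn ⟨
      A a                ∎)

mainTheorem4 : ∀ {n} (Q : Matroid n) (a : Fin n) → IsBinary Q →
    ¬ IsLoop full (Indep Q) a → ¬ IsColoop full (Indep Q) a →
    DeletionIsoMF Q a →
    (∀ e₁ e₂ e₃ → e₁ ≢ e₂ → e₁ ≢ e₃ → e₂ ≢ e₃ →
      ¬ (IsLoop (minorGround a) (ConIndep Q a) e₁ ×
         IsLoop (minorGround a) (ConIndep Q a) e₂ ×
         IsLoop (minorGround a) (ConIndep Q a) e₃)) ×
    (∀ C → ∣ C ∣ ≡ 2 → ¬ IsCocircuit (minorGround a) (ConIndep Q a) C) ×
    (∀ (f : Fin 5 → Fin n) → ¬ (∀ i j → i ≢ j →
      IsParallel (minorGround a) (ConIndep Q a) (f i) (f j)))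
mainTheorem4 Q a (_ , A , A-represents) a-nonloop a-noncoloop (φ , φ-injective , φ≢a , φ-onto , φ-iso) =
  contraction-no-three-loops , contraction-no-cocircuit-of-size-2 , contraction-no-five-parallel
  where open BinaryExtensionOfMF Q a A A-represents a-nonloop a-noncoloop φ φ-injective φ≢a φ-onto φ-iso
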